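{- For every realization of the random bits $X_1,\dots,X_{T-1}\in\{0,1\}$ in Algorithm 3, the map $S'_{wcs}$ computed by Algorithm 3 follows the precedence constraints: for every chain $\mathcal{C}_i$, $S'_{wcs}(J_i^1) < S'_{wcs}(J_i^2) < \cdots < S'_{wcs}(J_i^{|\mathcal{C}_i|})$.
   Context: Min-WCS problem. Input: a positive integer $n$ and job chains $\mathcal{C}_1,\dots,\mathcal{C}_n$, where $\mathcal{C}_i$ consists of $|\mathcal{C}_i|\geq 1$ jobs $J_i^1 \to \cdots \to J_i^{|\mathcal{C}_i|}$, each job $J_i^j$ having a non-negative weight $w_i^j$. With $T=\sum_i |\mathcal{C}_i|$, a feasible schedule $S$ is a bijection from the set of all jobs to $\{1,\dots,T\}$ with $S(J_i^1)<\cdots<S(J_i^{|\mathcal{C}_i|})$ for all $i$. Algorithm 1: for the job $J_i^j$ let $\rho_i^j = \max_{j \leq k \leq |\mathcal{C}_i|} \frac{w_i^j+\cdots+w_i^k}{k-j+1}$. For $t=1,\dots,T$: among the first not-yet-scheduled job of each chain that still has unscheduled jobs, pick one with maximum $\rho_i^j$ (ties arbitrary) and give it completion time $t$. Output $S^*_{wc}$. Algorithm 2: process the chains one after another, each chain entirely and contiguously in its chain order, in nondecreasing order of $|\mathcal{C}_i|$ (ties arbitrary). Output $S^*_{cs}$. Algorithm 3 with parameter $p\in[0,1]$: compute $S^*_{wc}$ and $S^*_{cs}$. Draw independent $X_1,\dots,X_{T-1}$, each equal to 1 with probability $p$ and 0 otherwise. For each job $J$ set $S^{int}_{cs}(J)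 = S^*_{cs}(J) + \sum_{i=1}^{S^*_{cs}(J)-1} X_i$. For $k=1,\dots,T$, for the job $J$ with $S^*_{wc}(J)=k$, set $S^{int}_{wc}(J)$ to the $k$-th smallest positive integer not in the image of $S^{int}_{cs}$. For each job $J$ set $S'_{wcs}(J)=\min\{S^{int}_{cs}(J), S^{int}_{wc}(J)\}$. Finally $S_{wcs}(J)$ is the rank of $S'_{wcs}(J)$ among the values $\{S'_{wcs}(J')\}$.
   Formalization: The job weights $w_i^j$ take values in the non-negative rationals. -}

module Defs where

open import Data.Nat as ℕ using (ℕ; zero; suc; _+_; _∸_; _⊓_; _<ᵇ_; _≡ᵇ_)
open import Data.Fin as Fin using (Fin; toℕ; fromℕ<)
open import Data.Bool using (Bool; true; false; if_then_else_; not)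
open import Data.List using (List; []; _∷_; map; concatMap)
open import Data.Bool.ListAction using (any)
import Data.List as List
open import Data.Product using (Σ; ∃; _×_; _,_)
open import Data.Integer using (+_)
open import Data.Rational as ℚ using (ℚ; 0ℚ)
open import Relation.Binary.PropositionalEquality using (_≡_)
open import Relation.Nullary using (yes; no)

-- Instance: n chains, chain i has len i jobs (indexed 0 .. len i - 1,
-- index j corresponds to the paper's J_i^{j+1}), weights w i j.

sumFin : (n : ℕ) → (Fin n → ℕ) → ℕ
sumFin zero    f = 0
sumFin (suc n) f = f Fin.zero + sumFin n (λ b → f (Fin.suc b))

totalJobs : (n : ℕ) → (Fin n → ℕ) → ℕ
totalJobs n len = sumFin n len

Job : (n : ℕ) → (Fin n → ℕ) → Set
Job n len = Σ (Fin n) (λ i → Fin (len i))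

allJobs : (n : ℕ) (len : Fin n → ℕ) → List (Job n len)
allJobs n len = concatMap (λ i → map (λ j → (i , j)) (List.allFin (len i))) (List.allFin n)

Feasible : (n : ℕ) (len : Fin n → ℕ) → (Job n len → ℕ) → Set
Feasible n len S =
  (∀ J → 1 ℕ.≤ S J × S J ℕ.≤ totalJobs n len)
  × (∀ J J' → S J ≡ S J' → J ≡ J')
  × (∀ t → 1 ℕ.≤ t → t ℕ.≤ totalJobs n len → ∃ λ J → S J ≡ t)
  × (∀ i (j j' : Fin (len i)) → j Fin.< j' → S (i , j) ℕ.< S (i , j'))

-- ρ_i^j = max_{j ≤ k < len i} (w_i^j + … + w_i^k) / (k - j + 1)

-- weight of position l of chain i (0 outside the chain; never used there)
wAt : (n : ℕ) (len : Fin n → ℕ) (w : (i : Fin n) → Fin (len i) → ℚ) →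
      Fin n → ℕ → ℚ
wAt n len w i l with l ℕ.<? len i
... | yes p = w i (fromℕ< p)
... | no  _ = 0ℚ

segSum : (n : ℕ) (len : Fin n → ℕ) (w : (i : Fin n) → Fin (len i) → ℚ) →
         Fin n → ℕ → ℕ → ℚ
segSum n len w i j zero    = 0ℚ
segSum n len w i j (suc c) = wAt n len w i j ℚ.+ segSum n len w i (suc j) c

segAvg : (n : ℕ) (len : Fin n → ℕ) (w : (i : Fin n) → Fin (len i) → ℚ) →
         Fin n → ℕ → ℕ → ℚ
segAvg n len w i j c = segSum n len w i j (suc c) ℚ.* ((+ 1) ℚ./ suc c)

segMax : (n : ℕ) (len : Fin n → ℕ) (w : (i : Fin n) → Fin (len i) → ℚ) →
         Fin n → ℕ → ℕ → ℚ
segMax n len w i j zero    = segAvg n len w i j zero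
segMax n len w i j (suc c) = segMax n len w i j c ℚ.⊔ segAvg n len w i j (suc c)

rho : (n : ℕ) (len : Fin n → ℕ) (w : (i : Fin n) → Fin (len i) → ℚ) →
      Job n len → ℚ
rho n len w (i , j) = segMax n len w i (toℕ j) (len i ∸ toℕ j ∸ 1)

-- Algorithm 1 (greedy by ρ, arbitrary tie-breaking): S is a possible
-- output iff it is feasible and at every time t = S J, the scheduled job J
-- has ρ at least that of the first not-yet-scheduled job of every chain
-- that still has unscheduled jobs.  The first unscheduled job of chain i'
-- at time t is the (unique) j' with S(i',j') ≥ t and S(i',j'') < t for
-- all j'' < j'.

IsAlg1Output : (n : ℕ) (len : Fin n → ℕ) (w : (i : Fin n) → Fin (len i) → ℚ) →
               (Job n len → ℕ) → Set
IsAlg1Output n len w S =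
  Feasible n len S
  × (∀ J i' (j' : Fin (len i')) →
       S J ℕ.≤ S (i' , j') →
       (∀ (j'' : Fin (len i')) → j'' Fin.< j' → S (i' , j'') ℕ.< S J) →
       rho n len w (i' , j') ℚ.≤ rho n len w J)

offset : (n : ℕ) (len : Fin n → ℕ) (π : Fin n → Fin n) → Fin n → ℕ
offset n len π a = sumFin n (λ b → if toℕ b <ᵇ toℕ a then len (π b) else 0)

IsAlg2Output : (n : ℕ) (len : Fin n → ℕ) → (Job n len → ℕ) → Set
IsAlg2Output n len S =
  Σ (Fin n → Fin n) λ π →
    (∀ a b → π a ≡ π b → a ≡ b)
    × (∀ a b → a Fin.< b → len (π a) ℕ.≤ len (π b))
    × (∀ a (j : Fin (len (π a))) → S (π a , j) ≡ offset n len π a + toℕ j + 1)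

-- Algorithm 3.  X : ℕ → Bool gives the bits; only X 1, …, X (T-1) are read.

bitVal : Bool → ℕ
bitVal true  = 1
bitVal false = 0

countX : (ℕ → Bool) → ℕ → ℕ
countX X zero    = 0
countX X (suc m) = countX X m + bitVal (X (suc m))

SintCS : (n : ℕ) (len : Fin n → ℕ) (Scs : Job n len → ℕ) (X : ℕ → Bool) →
         Job n len → ℕ
SintCS n len Scs X J = Scs J + countX X (Scs J ∸ 1)

inImage : (n : ℕ) (len : Fin n → ℕ) (Scs : Job n len → ℕ) (X : ℕ → Bool) →
          ℕ → Bool
inImage n len Scs X m = any (λ J → SintCS n len Scs X J ≡ᵇ m) (allJobs n len)

kthFreeFrom : (ℕ → Bool) → (fuel cur r : ℕ) → ℕ
kthFreeFrom img zero       cur r = cur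
kthFreeFrom img (suc fuel) cur r with img cur
... | true  = kthFreeFrom img fuel (suc cur) r
... | false = if r ≡ᵇ 1 then cur else kthFreeFrom img fuel (suc cur) (r ∸ 1)

-- k-th smallest positive integer not in the image of S^int_cs (k ≥ 1).
-- The image has T elements, so this integer is ≤ T + k; fuel T + k
-- therefore suffices.
kthFree : (n : ℕ) (len : Fin n → ℕ) (Scs : Job n len → ℕ) (X : ℕ → Bool) →
          ℕ → ℕ
kthFree n len Scs X k = kthFreeFrom (inImage n len Scs X) (totalJobs n len + k) 1 k

SintWC : (n : ℕ) (len : Fin n → ℕ) (Swc Scs : Job n len → ℕ) (X : ℕ → Bool) →
         Job n len → ℕ
SintWC n len Swc Scs X J = kthFree n len Scs X (Swc J)

S'wcs : (n : ℕ) (len : Fin n → ℕ) (Swc Scs : Job n len → ℕ) (X : ℕ → Bool) →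
        Job n len → ℕ
S'wcs n len Swc Scs X J = SintCS n len Scs X J ⊓ SintWC n len Swc Scs X J

module Submission where

open import Defs
open import Data.Nat using (ℕ; _≤_; _<_)
open import Data.Fin as Fin using (Fin)
open import Data.Bool using (Bool)
open import Data.Product using (_,_)
open import Data.Rational using (ℚ; 0ℚ)
import Data.Rational as ℚ

open import Data.Nat using (zero; suc; _+_; _∸_; _≡ᵇ_; s≤s)
open import Data.Nat.Properties
open import Data.Bool using (true; false)
open import Data.Product using (∃; proj₁)
open import Relation.Binary.PropositionalEquality using (_≡_; refl; sym; subst)
open import Relation.Nullary using (yes; no; contradiction)
import Data.Fin.Properties as Finₚ

-- S'wcs is the pointwise minimum of S^int_cs and S^int_wc, so it suffices that
-- both increase strictly along every chain.  S^int_cs adds to S*_cs a count of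
-- random bits that is monotone in S*_cs, and S*_cs increases along a chain
-- because Algorithm 2 schedules each chain contiguously in chain order.
-- S^int_wc is S*_wc composed with k ↦ (k-th free integer), which is strictly
-- increasing, and S*_wc is feasible.

kthFreeFrom-≥ : ∀ img fuel cur r → cur ≤ kthFreeFrom img fuel cur r
kthFreeFrom-≥ img zero       cur r = ≤-refl
kthFreeFrom-≥ img (suc fuel) cur r with img cur
... | true = ≤-trans (n≤1+n cur) (kthFreeFrom-≥ img fuel (suc cur) r)
... | false with r ≡ᵇ 1
...   | true  = ≤-refl
...   | false = ≤-trans (n≤1+n cur) (kthFreeFrom-≥ img fuel (suc cur) (r ∸ 1))

-- Ranks are written suc r, suc r' so that the test (r ≡ᵇ 1) reduces.
kthFreeFrom-strictMono : ∀ img {fuel fuel' cur r r'} → fuel < fuel' → r < r' →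
                         kthFreeFrom img fuel cur (suc r) < kthFreeFrom img fuel' cur (suc r')
kthFreeFrom-strictMono img {zero} {suc fuel'} {cur} {r' = suc r'} _ _ with img cur
... | true  = kthFreeFrom-≥ img fuel' (suc cur) (suc (suc r'))
... | false = kthFreeFrom-≥ img fuel' (suc cur) (suc r')
kthFreeFrom-strictMono img {suc fuel} {suc fuel'} {cur} {r} {suc r'} (s≤s fuel<fuel') r<r'
  with img cur | r
... | true  | _     = kthFreeFrom-strictMono img fuel<fuel' r<r'
... | false | zero  = kthFreeFrom-≥ img fuel' (suc cur) (suc r')
... | false | suc _ = kthFreeFrom-strictMono img fuel<fuel' (≤-pred r<r')

kthFree-strictMono : ∀ n len Scs X {k k'} → 1 ≤ k → k < k' →
                     kthFree n len Scs X k < kthFree n len Scs X k'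
kthFree-strictMono n len Scs X {suc k} {suc k'} _ k<k' =
  kthFreeFrom-strictMono (inImage n len Scs X) (+-monoʳ-< (totalJobs n len) k<k') (≤-pred k<k')

countX-≤-+ : ∀ X m d → countX X m ≤ countX X (d + m)
countX-≤-+ X m zero    = ≤-refl
countX-≤-+ X m (suc d) = ≤-trans (countX-≤-+ X m d) (m≤m+n _ _)

countX-mono : ∀ X {m m'} → m ≤ m' → countX X m ≤ countX X m'
countX-mono X {m} {m'} m≤m' =
  subst (λ l → countX X m ≤ countX X l) (m∸n+n≡m m≤m') (countX-≤-+ X m (m' ∸ m))

SintCS-strictMono : ∀ n len Scs X {J J'} → Scs J < Scs J' →
                    SintCS n len Scs X J < SintCS n len Scs X J'
SintCS-strictMono n len Scs X lt = +-mono-<-≤ lt (countX-mono X (∸-monoˡ-≤ 1 (<⇒≤ lt)))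

injective⇒surjective : ∀ {n} (π : Fin n → Fin n) → (∀ a b → π a ≡ π b → a ≡ b) →
                       ∀ i → ∃ λ a → π a ≡ i
injective⇒surjective {suc n} π π-inj i with Finₚ.any? (λ a → π a Finₚ.≟ i)
... | yes hit = hit
... | no miss = contradiction (Finₚ.injective⇒≤ squeeze-injective) (<-irrefl refl)
  where
  -- π misses i, so it factors through Fin n by punching out i.
  squeeze : Fin (suc n) → Fin n
  squeeze a = Fin.punchOut (λ eq → miss (a , sym eq))

  squeeze-injective : ∀ {a b} → squeeze a ≡ squeeze b → a ≡ b
  squeeze-injective {a} {b} eq =
    π-inj a b (Finₚ.punchOut-injective (λ e → miss (a , sym e)) (λ e → miss (b , sym e)) eq)

IsAlg2Output⇒chain-strictMono : ∀ n len S → IsAlg2Output n len S →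
                                ∀ i (j j' : Fin (len i)) → j Fin.< j' → S (i , j) < S (i , j')
IsAlg2Output⇒chain-strictMono n len S (π , π-inj , _ , position) i j j' j<j'
  with injective⇒surjective π π-inj i
... | a , refl rewrite position a j | position a j' =
  +-monoˡ-< 1 (+-monoʳ-< (offset n len π a) j<j')

lemma5 : (n : ℕ) → 1 ≤ n →
         (len : Fin n → ℕ) → (∀ i → 1 ≤ len i) →
         (w : (i : Fin n) → Fin (len i) → ℚ) → (∀ i j → 0ℚ ℚ.≤ w i j) →
         (Swc Scs : Job n len → ℕ) →
         IsAlg1Output n len w Swc →
         IsAlg2Output n len Scs →
         (X : ℕ → Bool) →
         ∀ i (j j' : Fin (len i)) → j Fin.< j' →
         S'wcs n len Swc Scs X (i , j) < S'wcs n len Swc Scs X (i , j')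
lemma5 n _ len _ w _ Swc Scs ((bounds , _ , _ , chain) , _) alg2 X i j j' j<j' =
  ⊓-mono-<
    (SintCS-strictMono n len Scs X (IsAlg2Output⇒chain-strictMono n len Scs alg2 i j j' j<j'))
    (kthFree-strictMono n len Scs X (proj₁ (bounds (i , j))) (chain i j j' j<j'))
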